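{- Let $p$ be an odd prime and let $x,y$ be integers with $X^2+105=6y^p$, where $X=6x+21$. Let $K=\mathbb{Q}(\sqrt{ -105})$ with ring of integers $\mathcal{O}_K=\mathbb{Z}[\sqrt{ -105}]$, and let $\mathfrak{p}_2,\mathfrak{p}_3$ be the unique prime ideals of $\mathcal{O}_K$ above $2$ and $3$ respectively. Let $\gamma\in\mathcal{O}_K$ satisfy $\operatorname{ord}_{\mathfrak{p}_2}(\gamma)=\operatorname{ord}_{\mathfrak{p}_3}(\gamma)=1$ and \[ X+\sqrt{ -105}=\frac{\gamma^p}{6^{(p-1)/2}}. \] Let $L=\mathbb{Q}(\sqrt{ -105},\sqrt{6})$, fix a square root $\sqrt6\in L$, let $\bar\gamma$ denote the complex conjugate of $\gamma$, and set \[ \alpha=\frac{\gamma}{\sqrt6},\qquad \beta=\frac{\bar\gamma}{\sqrt6}. \] Then $\alpha$ and $\beta$ are algebraic integers, $(\alpha+\beta)^2$ and $\alpha\beta$ are non-zero, coprime rational integers, and $\alpha/\beta$ is not a root of unity. -}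

module Defs where

open import Data.Nat as ℕ using (ℕ; zero; suc)
open import Data.Integer as ℤ using (ℤ; +_; -[1+_])
open import Data.Rational as ℚ using (ℚ; _/_)
open import Data.Vec using (Vec; []; _∷_)
open import Data.Product using (Σ; _×_; _,_)
open import Relation.Binary.PropositionalEquality using (_≡_)
open import Relation.Nullary using (¬_)

-- O_K = ℤ[√-105] : elements a + b √-105

record OK : Set where
  constructor mkOK
  field
    re : ℤ
    im : ℤ
open OK public

infixl 6 _+K_
infixl 7 _*K_
_+K_ : OK → OK → OK
mkOK a b +K mkOK c d = mkOK (a ℤ.+ c) (b ℤ.+ d)

_*K_ : OK → OK → OK
mkOK a b *K mkOK c d = mkOK (a ℤ.* c ℤ.- ℤ.+ 105 ℤ.* (b ℤ.* d)) (a ℤ.* d ℤ.+ b ℤ.* c)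

fromℤK : ℤ → OK
fromℤK a = mkOK a (ℤ.+ 0)

√-105K : OK
√-105K = mkOK (ℤ.+ 0) (ℤ.+ 1)

_^K_ : OK → ℕ → OK
x ^K zero  = fromℤK (ℤ.+ 1)
x ^K suc n = x *K (x ^K n)

conjK : OK → OK
conjK (mkOK a b) = mkOK a (ℤ.- b)

In₂ : OK → OK → OK → Set
In₂ x g₁ g₂ = Σ OK λ r → Σ OK λ s → x ≡ r *K g₁ +K s *K g₂

In₃ : OK → OK → OK → OK → Set
In₃ x g₁ g₂ g₃ =
  Σ OK λ r → Σ OK λ s → Σ OK λ t → x ≡ r *K g₁ +K s *K g₂ +K t *K g₃

-- 𝔭₂ = (2, 1 + √-105), the unique prime of O_K above 2 (2 ramifies)
-- 𝔭₃ = (3, √-105),     the unique prime of O_K above 3 (3 ramifies)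
-- ord_𝔭(γ) = 1  ⇔  γ ∈ 𝔭 and γ ∉ 𝔭²; 𝔭² is generated by the pairwise
-- products of the generators of 𝔭.
ord𝔭₂≡1 : OK → Set
ord𝔭₂≡1 γ = In₂ γ g h × ¬ (In₃ γ (g *K g) (g *K h) (h *K h))
  where g = fromℤK (ℤ.+ 2); h = mkOK (ℤ.+ 1) (ℤ.+ 1)

ord𝔭₃≡1 : OK → Set
ord𝔭₃≡1 γ = In₂ γ g h × ¬ (In₃ γ (g *K g) (g *K h) (h *K h))
  where g = fromℤK (ℤ.+ 3); h = √-105K

-- L = ℚ(√-105, √6) as a ℚ-vector space with basis 1, t, s, ts where
-- t = √-105, s = √6 (so t² = -105, s² = 6, (ts)² = -630).

record L : Set where
  constructor mkL
  field
    c₀ c₁ c₂ c₃ : ℚ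

infixl 6 _+L_
infixl 7 _*L_
_+L_ : L → L → L
mkL a₀ a₁ a₂ a₃ +L mkL b₀ b₁ b₂ b₃ =
  mkL (a₀ ℚ.+ b₀) (a₁ ℚ.+ b₁) (a₂ ℚ.+ b₂) (a₃ ℚ.+ b₃)

private
  q : ℤ → ℚ
  q n = n / 1

_*L_ : L → L → L
mkL a₀ a₁ a₂ a₃ *L mkL b₀ b₁ b₂ b₃ = mkL
  (a₀ ℚ.* b₀ ℚ.+ q (ℤ.- ℤ.+ 105) ℚ.* (a₁ ℚ.* b₁) ℚ.+ q (ℤ.+ 6) ℚ.* (a₂ ℚ.* b₂)
     ℚ.+ q (ℤ.- ℤ.+ 630) ℚ.* (a₃ ℚ.* b₃))
  (a₀ ℚ.* b₁ ℚ.+ a₁ ℚ.* b₀ ℚ.+ q (ℤ.+ 6) ℚ.* (a₂ ℚ.* b₃ ℚ.+ a₃ ℚ.* b₂))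
  (a₀ ℚ.* b₂ ℚ.+ a₂ ℚ.* b₀ ℚ.+ q (ℤ.- ℤ.+ 105) ℚ.* (a₁ ℚ.* b₃ ℚ.+ a₃ ℚ.* b₁))
  (a₀ ℚ.* b₃ ℚ.+ a₃ ℚ.* b₀ ℚ.+ a₁ ℚ.* b₂ ℚ.+ a₂ ℚ.* b₁)

ℤ→L : ℤ → L
ℤ→L n = mkL (n / 1) ℚ.0ℚ ℚ.0ℚ ℚ.0ℚ

0L 1L : L
0L = ℤ→L (ℤ.+ 0)
1L = ℤ→L (ℤ.+ 1)

OK→L : OK → L
OK→L (mkOK a b) = mkL (a / 1) (b / 1) ℚ.0ℚ ℚ.0ℚ

_^L_ : L → ℕ → L
x ^L zero  = 1L
x ^L suc n = x *L (x ^L n)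

-- evaluation of the monic polynomial  X^n + c_{n-1} X^{n-1} + … + c₀,
-- coefficients given as (c₀ ∷ c₁ ∷ … ∷ c_{n-1})
evalMonic : ∀ {n} → Vec ℤ n → L → L
evalMonic {zero}  []       x = 1L
evalMonic {suc n} (c ∷ cs) x = evalMonic cs x *L x +L ℤ→L c

IsAlgebraicInteger : L → Set
IsAlgebraicInteger x = Σ ℕ λ n → Σ (Vec ℤ n) λ cs → evalMonic cs x ≡ 0L

IsRootOfUnity : L → Set
IsRootOfUnity z = Σ ℕ λ n → (1 ℕ.≤ n) × (z ^L n ≡ 1L)

{-# OPTIONS --safe #-}

-- By the valuation conditions γ = 3A + B√-105 with A, B odd and 3 ∤ B. With
-- n = (3A² + 35B²)/2 and δ = (3A² - n) + AB√-105 one has γγ̄ = 6n and γ² = 6δ, so dividing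
-- by √6 gives αβ = n, α² = δ, β² = δ̄ and (α + β)² = Tr δ + 2n = 6A²; α and β are roots of
-- X⁴ - Tr(δ) X² + N(δ). A common prime factor of 6A² and n is odd and, as
-- 3 ∤ 35B² = 2n - 3A², different from 3; so it divides A and 35B², hence γ², hence
-- Im γᵖ = 6ᵏ, which is absurd. If α/β were a root of unity, some δᵏ = δ̄ᵏ would be rational;
-- a prime factor of n then divides N(δᵏ) = (Re δᵏ)², hence Tr(δᵏ), hence (Tr δ)ᵏ by the
-- congruence Tr(δᵏ) ≡ (Tr δ)ᵏ mod N(δ) = n², hence Tr δ and 6A² = Tr δ + 2n, which
-- contradicts the coprimality of 6A² and n.

module Submission where

open import Defs
open import Data.Nat as ℕ using (ℕ; zero; suc)
open import Data.Nat.Primality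
  using (Prime; prime[2]; prime?; ¬prime[0]; ¬prime[1]; euclidsLemma; prime⇒irreducible)
open import Data.Nat.Primality.Factorisation using (factorise)
import Data.Nat.Divisibility as ℕᵈ
import Data.Nat.GCD as ℕᵍ
open import Data.Integer as ℤ using (ℤ; +_; -[1+_]; _+_; _*_; _-_; -_; _^_)
import Data.Integer.Properties as ℤP
import Data.Integer.DivMod as ℤᵈ
open import Data.Integer.Divisibility.Signed
open import Data.Integer.GCD using (gcd)
open import Data.Integer.Tactic.RingSolver using (solve-∀; solve)
open import Data.Rational as ℚ using (ℚ; _/_; 0ℚ; 1ℚ)
import Data.Rational.Properties as ℚP
import Data.Rational.Unnormalised as ℚᵘ
import Data.Rational.Unnormalised.Properties as ℚᵘP
open import Data.Rational.Solver using (module +-*-Solver)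
open import Data.Fin using (combine; #_)
open import Data.List using ([]; _∷_)
import Data.List.Relation.Unary.All as All
open import Data.Vec using (Vec)
open import Data.Vec.N-ary using (N-ary; _$ⁿ_)
open import Data.Product using (Σ; ∃; ∃₂; _×_; _,_; proj₁; proj₂)
open import Data.Sum using (_⊎_; inj₁; inj₂; [_,_]′; reduce)
open import Data.Empty using (⊥; ⊥-elim)
open import Relation.Nullary using (¬_)
open import Relation.Nullary.Decidable using (from-yes; from-no)
open import Relation.Binary.PropositionalEquality
open import Function using (_∘_; id)

open +-*-Solver using (Polynomial; con; var; _:+_; _:*_; _:-_; ⟦_⟧; ⟦_⟧↓; prove)

-- Prime divisors of integers

prime[3] : Prime 3
prime[3] = from-yes (prime? 3)

euclidsLemmaℤ : ∀ {ℓ} i j → Prime ℓ → + ℓ ∣ i * j → + ℓ ∣ i ⊎ + ℓ ∣ j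
euclidsLemmaℤ i j ℓ-prime ℓ∣ij
  with euclidsLemma ℤ.∣ i ∣ ℤ.∣ j ∣ ℓ-prime (subst (_ ℕᵈ.∣_) (ℤP.abs-* i j) (∣⇒∣ᵤ ℓ∣ij))
... | inj₁ ℓ∣i = inj₁ (∣ᵤ⇒∣ ℓ∣i)
... | inj₂ ℓ∣j = inj₂ (∣ᵤ⇒∣ ℓ∣j)

prime∣^⇒prime∣ : ∀ {ℓ} i k → Prime ℓ → + ℓ ∣ i ^ k → + ℓ ∣ i
prime∣^⇒prime∣ i zero ℓ-prime ℓ∣1 with ℕᵈ.∣1⇒≡1 (∣⇒∣ᵤ ℓ∣1)
... | refl = ⊥-elim (¬prime[1] ℓ-prime)
prime∣^⇒prime∣ i (suc k) ℓ-prime ℓ∣iᵏ⁺¹ with euclidsLemmaℤ i (i ^ k) ℓ-prime ℓ∣iᵏ⁺¹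
... | inj₁ ℓ∣i = ℓ∣i
... | inj₂ ℓ∣iᵏ = prime∣^⇒prime∣ i k ℓ-prime ℓ∣iᵏ

prime∣prime⇒≡ : ∀ {ℓ q} → Prime ℓ → Prime q → + ℓ ∣ + q → ℓ ≡ q
prime∣prime⇒≡ ℓ-prime q-prime ℓ∣q with prime⇒irreducible q-prime (∣⇒∣ᵤ ℓ∣q)
... | inj₁ refl = ⊥-elim (¬prime[1] ℓ-prime)
... | inj₂ ℓ≡q = ℓ≡q

prime∣6⇒2⊎3 : ∀ {ℓ} → Prime ℓ → + ℓ ∣ + 6 → ℓ ≡ 2 ⊎ ℓ ≡ 3
prime∣6⇒2⊎3 ℓ-prime ℓ∣6 with euclidsLemmaℤ (+ 2) (+ 3) ℓ-prime ℓ∣6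
... | inj₁ ℓ∣2 = inj₁ (prime∣prime⇒≡ ℓ-prime prime[2] ℓ∣2)
... | inj₂ ℓ∣3 = inj₂ (prime∣prime⇒≡ ℓ-prime prime[3] ℓ∣3)

3∤35 : ¬ + 3 ∣ + 35
3∤35 3∣35 = from-no (3 ℕᵈ.∣? 35) (∣⇒∣ᵤ 3∣35)

2∤1+2i : ∀ i → ¬ + 2 ∣ + 1 + + 2 * i
2∤1+2i i 2∣1+2i = from-no (2 ℕᵈ.∣? 1) (∣⇒∣ᵤ {+ 2} {+ 1} (∣m+n∣n⇒∣m 2∣1+2i (∣m⇒∣m*n i ∣-refl)))

¬2∣⇒odd : ∀ b → ¬ + 2 ∣ b → ∃ λ j → b ≡ + 1 + + 2 * j
¬2∣⇒odd b 2∤b = by-remainder (b ℤᵈ.%ℕ 2) (ℤᵈ.n%ℕd<d b 2) (ℤᵈ.a≡a%ℕn+[a/ℕn]*n b 2)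
  where
  by-remainder : ∀ r → r ℕ.< 2 → b ≡ + r + b ℤᵈ./ℕ 2 * + 2 → ∃ λ j → b ≡ + 1 + + 2 * j
  by-remainder 0 _ b≡q*2 = ⊥-elim (2∤b (divides (b ℤᵈ./ℕ 2) (trans b≡q*2 (ℤP.+-identityˡ _))))
  by-remainder 1 _ b≡1+q*2 = b ℤᵈ./ℕ 2 , trans b≡1+q*2 (cong (_+_ (+ 1)) (ℤP.*-comm (b ℤᵈ./ℕ 2) (+ 2)))
  by-remainder (suc (suc r)) (ℕ.s≤s (ℕ.s≤s ()))

prime-divisor : ∀ t → ∃ λ ℓ → Prime ℓ × + ℓ ∣ + suc (suc t)
prime-divisor t with factorise (suc (suc t))
... | record { factors = [] ; isFactorisation = () }
... | record { factors = ℓ ∷ _ ; isFactorisation = eq ; factorsPrime = ℓ-prime All.∷ _ } =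
  ℓ , ℓ-prime , ∣ᵤ⇒∣ (subst (ℓ ℕᵈ.∣_) (sym eq) (ℕᵈ.m∣m*n _))

no-common-prime⇒gcd≡1 : ∀ m n → n ≢ + 0 → (∀ {ℓ} → Prime ℓ → + ℓ ∣ m → + ℓ ∣ n → ⊥) → gcd m n ≡ + 1
no-common-prime⇒gcd≡1 m n n≢0 no-common-prime with ℕᵍ.gcd ℤ.∣ m ∣ ℤ.∣ n ∣ in g≡
... | zero = ⊥-elim (n≢0 (ℤP.∣i∣≡0⇒i≡0 (ℕᵍ.gcd[m,n]≡0⇒n≡0 ℤ.∣ m ∣ g≡)))
... | suc zero = refl
... | suc (suc t) with prime-divisor t
...   | ℓ , ℓ-prime , ℓ∣g = ⊥-elim (no-common-prime ℓ-prime
          (via-gcd (ℕᵍ.gcd[m,n]∣m ℤ.∣ m ∣ ℤ.∣ n ∣)) (via-gcd (ℕᵍ.gcd[m,n]∣n ℤ.∣ m ∣ ℤ.∣ n ∣)))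
  where
  via-gcd : ∀ {i} → ℕᵍ.gcd ℤ.∣ m ∣ ℤ.∣ n ∣ ℕᵈ.∣ ℤ.∣ i ∣ → + ℓ ∣ i
  via-gcd g∣i = ∣ᵤ⇒∣ (ℕᵈ.∣-trans (∣⇒∣ᵤ ℓ∣g) (subst (ℕᵈ._∣ _) g≡ g∣i))

-- The order ℤ[√-105]

nrm : OK → ℤ
nrm (mkOK a b) = a * a + + 105 * (b * b)

tr : OK → ℤ
tr x = + 2 * re x

*K-assoc : ∀ x y z → (x *K y) *K z ≡ x *K (y *K z)
*K-assoc (mkOK a b) (mkOK c d) (mkOK e f) = cong₂ mkOK (re-assoc a b c d e f) (im-assoc a b c d e f)
  where
  re-assoc : ∀ a b c d e f →
    (a * c - + 105 * (b * d)) * e - + 105 * ((a * d + b * c) * f) ≡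
    a * (c * e - + 105 * (d * f)) - + 105 * (b * (c * f + d * e))
  re-assoc = solve-∀
  im-assoc : ∀ a b c d e f →
    (a * c - + 105 * (b * d)) * f + (a * d + b * c) * e ≡
    a * (c * f + d * e) + b * (c * e - + 105 * (d * f))
  im-assoc = solve-∀

fromℤK-*K : ∀ c x → fromℤK c *K x ≡ mkOK (c * re x) (c * im x)
fromℤK-*K c (mkOK a b) = cong₂ mkOK (re-scale c a b) (im-scale c a b)
  where
  re-scale : ∀ c a b → c * a - + 105 * (+ 0 * b) ≡ c * a
  re-scale = solve-∀
  im-scale : ∀ c a b → c * b + + 0 * a ≡ c * b
  im-scale = solve-∀

fromℤK-^K : ∀ c k → fromℤK c ^K k ≡ fromℤK (c ^ k)
fromℤK-^K c zero = refl
fromℤK-^K c (suc k) = begin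
  fromℤK c *K (fromℤK c ^K k)  ≡⟨ cong (fromℤK c *K_) (fromℤK-^K c k) ⟩
  fromℤK c *K fromℤK (c ^ k)   ≡⟨ fromℤK-*K c (fromℤK (c ^ k)) ⟩
  mkOK (c * c ^ k) (c * + 0)    ≡⟨ cong (mkOK _) (ℤP.*-zeroʳ c) ⟩
  fromℤK (c ^ suc k)           ∎
  where open ≡-Reasoning

im-fromℤK^K-*K : ∀ c k w → im (fromℤK c ^K k *K w) ≡ c ^ k * im w
im-fromℤK^K-*K c k w = cong im (trans (cong (_*K w) (fromℤK-^K c k)) (fromℤK-*K (c ^ k) w))

conjK-*K : ∀ x y → conjK (x *K y) ≡ conjK x *K conjK y
conjK-*K (mkOK a b) (mkOK c d) = cong₂ mkOK (re-conj a b c d) (im-conj a b c d)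
  where
  re-conj : ∀ a b c d → a * c - + 105 * (b * d) ≡ a * c - + 105 * (- b * - d)
  re-conj = solve-∀
  im-conj : ∀ a b c d → - (a * d + b * c) ≡ a * - d + - b * c
  im-conj = solve-∀

conjK-^K : ∀ x k → conjK (x ^K k) ≡ conjK x ^K k
conjK-^K x zero = refl
conjK-^K x (suc k) = trans (conjK-*K x (x ^K k)) (cong (conjK x *K_) (conjK-^K x k))

*K-conjK : ∀ x → x *K conjK x ≡ fromℤK (nrm x)
*K-conjK (mkOK a b) = cong₂ mkOK (re-norm a b) (im-norm a b)
  where
  re-norm : ∀ a b → a * a - + 105 * (b * - b) ≡ a * a + + 105 * (b * b)
  re-norm = solve-∀
  im-norm : ∀ a b → a * - b + b * a ≡ + 0
  im-norm = solve-∀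

+K-conjK : ∀ x → x +K conjK x ≡ fromℤK (tr x)
+K-conjK (mkOK a b) = cong₂ mkOK (a+a≡2a a) (ℤP.+-inverseʳ b)
  where
  a+a≡2a : ∀ a → a + a ≡ + 2 * a
  a+a≡2a = solve-∀

cayley-hamilton : ∀ x → (x +K fromℤK (- tr x)) *K x +K fromℤK (nrm x) ≡ fromℤK (+ 0)
cayley-hamilton (mkOK a b) = cong₂ mkOK (re-ch a b) (im-ch a b)
  where
  re-ch : ∀ a b → (a + - (+ 2 * a)) * a - + 105 * ((b + + 0) * b) + (a * a + + 105 * (b * b)) ≡ + 0
  re-ch = solve-∀
  im-ch : ∀ a b → (a + - (+ 2 * a)) * b + (b + + 0) * a + + 0 ≡ + 0
  im-ch = solve-∀

nrm-*K : ∀ x y → nrm (x *K y) ≡ nrm x * nrm y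
nrm-*K (mkOK a b) (mkOK c d) = brahmagupta a b c d
  where
  brahmagupta : ∀ a b c d →
    (a * c - + 105 * (b * d)) * (a * c - + 105 * (b * d)) + + 105 * ((a * d + b * c) * (a * d + b * c)) ≡
    (a * a + + 105 * (b * b)) * (c * c + + 105 * (d * d))
  brahmagupta = solve-∀

nrm-^K : ∀ x k → nrm (x ^K k) ≡ nrm x ^ k
nrm-^K x zero = refl
nrm-^K x (suc k) = trans (nrm-*K x (x ^K k)) (cong (nrm x *_) (nrm-^K x k))

im≡0⇒nrm≡re² : ∀ x → im x ≡ + 0 → nrm x ≡ re x * re x
im≡0⇒nrm≡re² (mkOK a .(+ 0)) refl = ℤP.+-identityʳ (a * a)

conjK-fixed⇒im≡0 : ∀ x → conjK x ≡ x → im x ≡ + 0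
conjK-fixed⇒im≡0 (mkOK a b) x̄≡x = -i≡i⇒i≡0 b (cong im x̄≡x)
  where
  -i≡i⇒i≡0 : ∀ i → - i ≡ i → i ≡ + 0
  -i≡i⇒i≡0 (+ zero)  _  = refl
  -i≡i⇒i≡0 (+ suc n) ()
  -i≡i⇒i≡0 -[1+ n ]  ()

re-*K-*K : ∀ x w → re (x *K (x *K w)) ≡ tr x * re (x *K w) - nrm x * re w
re-*K-*K (mkOK a b) (mkOK c d) = lucas a b c d
  where
  lucas : ∀ a b c d →
    a * (a * c - + 105 * (b * d)) - + 105 * (b * (a * d + b * c)) ≡
    + 2 * a * (a * c - + 105 * (b * d)) - (a * a + + 105 * (b * b)) * c
  lucas = solve-∀

lucas-congruence : ∀ x k → nrm x ∣ tr x ^ suc k - tr (x ^K suc k)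
lucas-congruence x zero = divides (+ 0) (base (re x) (im x))
  where
  base : ∀ a b → + 2 * a * + 1 - + 2 * (a * + 1 - + 105 * (b * + 0)) ≡ + 0
  base = solve-∀
lucas-congruence x (suc k) = subst (nrm x ∣_) (sym recurrence)
  (∣m∣n⇒∣m+n (∣n⇒∣m*n (tr x) (lucas-congruence x k)) (∣m⇒∣m*n (tr (x ^K k)) ∣-refl))
  where
  step : ∀ T P r₁ N r₀ → T * P - + 2 * (T * r₁ - N * r₀) ≡ T * (P - + 2 * r₁) + N * (+ 2 * r₀)
  step = solve-∀
  recurrence : tr x ^ suc (suc k) - tr (x ^K suc (suc k)) ≡
               tr x * (tr x ^ suc k - tr (x ^K suc k)) + nrm x * tr (x ^K k)
  recurrence = trans (cong (λ r → tr x ^ suc (suc k) - + 2 * r) (re-*K-*K x (x ^K k)))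
                     (step (tr x) (tr x ^ suc k) (re (x ^K suc k)) (nrm x) (re (x ^K k)))

infix 4 _∣K_

_∣K_ : ℤ → OK → Set
d ∣K x = d ∣ re x × d ∣ im x

∣K-*ʳ : ∀ {d} x y → d ∣K x → d ∣K x *K y
∣K-*ʳ (mkOK a b) (mkOK c e) (d∣a , d∣b) =
  ∣m∣n⇒∣m-n (∣m⇒∣m*n c d∣a) (∣n⇒∣m*n (+ 105) (∣m⇒∣m*n e d∣b)) ,
  ∣m∣n⇒∣m+n (∣m⇒∣m*n e d∣a) (∣m⇒∣m*n c d∣b)

∣K-square⇒∣K-^ : ∀ {d} x k → d ∣K x *K x → d ∣K x ^K suc (suc k)
∣K-square⇒∣K-^ x k d∣x² = subst (_ ∣K_) (*K-assoc x x (x ^K k)) (∣K-*ʳ (x *K x) (x ^K k) d∣x²)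

real-power⇒prime∣nrm⇒prime∣tr : ∀ {ℓ} x k → x ^K suc k ≡ conjK x ^K suc k →
  Prime ℓ → + ℓ ∣ nrm x → + ℓ ∣ tr x
real-power⇒prime∣nrm⇒prime∣tr {ℓ} x k xᵏ≡x̄ᵏ ℓ-prime ℓ∣N =
  prime∣^⇒prime∣ (tr x) (suc k) ℓ-prime
    (∣m+n∣n⇒∣m (∣-trans ℓ∣N (lucas-congruence x k)) (∣m⇒∣-m ℓ∣tr[xᵏ]))
  where
  xᵏ = x ^K suc k
  im[xᵏ]≡0 : im xᵏ ≡ + 0
  im[xᵏ]≡0 = conjK-fixed⇒im≡0 xᵏ (trans (conjK-^K x (suc k)) (sym xᵏ≡x̄ᵏ))
  ℓ∣re[xᵏ]² : + ℓ ∣ re xᵏ * re xᵏ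
  ℓ∣re[xᵏ]² = subst (+ ℓ ∣_) (trans (sym (nrm-^K x (suc k))) (im≡0⇒nrm≡re² xᵏ im[xᵏ]≡0)) (∣m⇒∣m*n _ ℓ∣N)
  ℓ∣tr[xᵏ] : + ℓ ∣ tr xᵏ
  ℓ∣tr[xᵏ] = ∣n⇒∣m*n (+ 2) (reduce (euclidsLemmaℤ (re xᵏ) (re xᵏ) ℓ-prime ℓ∣re[xᵏ]²))

-- The primes above 2 and 3

𝔭₂ 𝔭₃ 𝔭₂² 𝔭₃² : OK → Set
𝔭₂ x = In₂ x (fromℤK (+ 2)) (mkOK (+ 1) (+ 1))
𝔭₃ x = In₂ x (fromℤK (+ 3)) √-105K
𝔭₂² x = In₃ x (fromℤK (+ 2) *K fromℤK (+ 2)) (fromℤK (+ 2) *K mkOK (+ 1) (+ 1))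
                (mkOK (+ 1) (+ 1) *K mkOK (+ 1) (+ 1))
𝔭₃² x = In₃ x (fromℤK (+ 3) *K fromℤK (+ 3)) (fromℤK (+ 3) *K √-105K) (√-105K *K √-105K)

∈𝔭₂⇒2∣re-im : ∀ x → 𝔭₂ x → + 2 ∣ re x - im x
∈𝔭₂⇒2∣re-im _ (mkOK r₀ r₁ , mkOK s₀ s₁ , refl) = divides (r₀ - r₁ - + 53 * s₁) (expand r₀ r₁ s₀ s₁)
  where
  expand : ∀ r₀ r₁ s₀ s₁ →
    r₀ * + 2 - + 105 * (r₁ * + 0) + (s₀ * + 1 - + 105 * (s₁ * + 1)) - (r₀ * + 0 + r₁ * + 2 + (s₀ * + 1 + s₁ * + 1))
      ≡ (r₀ - r₁ - + 53 * s₁) * + 2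
  expand = solve-∀

∈𝔭₃⇒3∣re : ∀ x → 𝔭₃ x → + 3 ∣ re x
∈𝔭₃⇒3∣re _ (mkOK r₀ r₁ , mkOK s₀ s₁ , refl) = divides (r₀ - + 35 * s₁) (expand r₀ r₁ s₀ s₁)
  where
  expand : ∀ r₀ r₁ s₀ s₁ →
    r₀ * + 3 - + 105 * (r₁ * + 0) + (s₀ * + 0 - + 105 * (s₁ * + 1)) ≡ (r₀ - + 35 * s₁) * + 3
  expand = solve-∀

-- 2 = -26·2² + 2(1 + √-105) - (1 + √-105)², so (2) ⊆ 𝔭₂².
2∣K⇒∈𝔭₂² : ∀ x → + 2 ∣K x → 𝔭₂² x
2∣K⇒∈𝔭₂² (mkOK .(a * + 2) .(b * + 2)) (divides a refl , divides b refl) =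
  mkOK (- (+ 26) * a) (- (+ 26) * b) , mkOK a b , mkOK (- a) (- b) , cong₂ mkOK (re-expand a b) (im-expand a b)
  where
  re-expand : ∀ a b → a * + 2 ≡
    - (+ 26) * a * + 4 - + 105 * (- (+ 26) * b * + 0) + (a * + 2 - + 105 * (b * + 2))
      + (- a * - (+ 104) - + 105 * (- b * + 2))
  re-expand = solve-∀
  im-expand : ∀ a b → b * + 2 ≡
    - (+ 26) * a * + 0 + - (+ 26) * b * + 4 + (a * + 2 + b * + 2) + (- a * + 2 + - b * - (+ 104))
  im-expand = solve-∀

-- 3 = 12·3² + (√-105)², so (3) ⊆ 𝔭₃².
3∣K⇒∈𝔭₃² : ∀ x → + 3 ∣K x → 𝔭₃² x
3∣K⇒∈𝔭₃² (mkOK .(a * + 3) .(b * + 3)) (divides a refl , divides b refl) =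
  mkOK (+ 12 * a) (+ 12 * b) , mkOK (+ 0) (+ 0) , mkOK a b , cong₂ mkOK (re-expand a b) (im-expand a b)
  where
  re-expand : ∀ a b → a * + 3 ≡
    + 12 * a * + 9 - + 105 * (+ 12 * b * + 0) + (+ 0 * + 0 - + 105 * (+ 0 * + 3))
      + (a * - (+ 105) - + 105 * (b * + 0))
  re-expand = solve-∀
  im-expand : ∀ a b → b * + 3 ≡
    + 12 * a * + 0 + + 12 * b * + 9 + (+ 0 * + 3 + + 0 * + 0) + (a * + 0 + b * - (+ 105))
  im-expand = solve-∀

γ-shape : ∀ γ → ord𝔭₂≡1 γ → ord𝔭₃≡1 γ →
  ∃₂ λ i j → γ ≡ mkOK (+ 3 * (+ 1 + + 2 * i)) (+ 1 + + 2 * j) × ¬ + 3 ∣ + 1 + + 2 * j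
γ-shape (mkOK a b) (∈𝔭₂ , ∉𝔭₂²) (∈𝔭₃ , ∉𝔭₃²) with ∈𝔭₃⇒3∣re _ ∈𝔭₃
... | divides a′ refl with ¬2∣⇒odd a′ 2∤a′ | ¬2∣⇒odd b 2∤b
  where
  2∣a-b : + 2 ∣ a′ * + 3 - b
  2∣a-b = ∈𝔭₂⇒2∣re-im _ ∈𝔭₂
  2∤b : ¬ + 2 ∣ b
  2∤b 2∣b = ∉𝔭₂² (2∣K⇒∈𝔭₂² _ (∣m+n∣n⇒∣m 2∣a-b (∣m⇒∣-m 2∣b) , 2∣b))
  2∤a′ : ¬ + 2 ∣ a′
  2∤a′ 2∣a′ = 2∤b (subst (+ 2 ∣_) (ℤP.neg-involutive b) (∣m⇒∣-m (∣m+n∣m⇒∣n 2∣a-b (∣m⇒∣m*n (+ 3) 2∣a′))))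
... | i , refl | j , refl = i , j , cong (λ a → mkOK a _) (ℤP.*-comm _ (+ 3)) , 3∤b
  where
  3∤b : ¬ + 3 ∣ + 1 + + 2 * j
  3∤b 3∣b = ∉𝔭₃² (3∣K⇒∈𝔭₃² _ (divides (+ 1 + + 2 * i) refl , 3∣b))

-- The field L = ℚ(√-105, √6)

-- Vec's constructors are opened only here, so that the List arguments of the integer solve
-- macro elsewhere are unambiguous.
module _ where

  open import Data.Vec using ([]; _∷_; concat; map; tabulate)

  ι : ℤ → ℚ
  ι i = i / 1

  toℚᵘ-ι : ∀ i → ℚ.toℚᵘ (ι i) ℚᵘ.≃ ℚᵘ.mkℚᵘ i 0
  toℚᵘ-ι i = ℚP.toℚᵘ-fromℚᵘ (ℚᵘ.mkℚᵘ i 0)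

  ι-injective : ∀ {i j} → ι i ≡ ι j → i ≡ j
  ι-injective {i} {j} ιi≡ιj = ℤP.*-cancelʳ-≡ i j (+ 1) (ℚᵘP.drop-*≡* (begin
    ℚᵘ.mkℚᵘ i 0     ≈⟨ toℚᵘ-ι i ⟨
    ℚ.toℚᵘ (ι i)    ≡⟨ cong ℚ.toℚᵘ ιi≡ιj ⟩
    ℚ.toℚᵘ (ι j)    ≈⟨ toℚᵘ-ι j ⟩
    ℚᵘ.mkℚᵘ j 0     ∎))
    where open ℚᵘP.≃-Reasoning

  ι-* : ∀ i j → ι (i * j) ≡ ι i ℚ.* ι j
  ι-* i j = ℚP.toℚᵘ-injective (begin
    ℚ.toℚᵘ (ι (i * j))                ≈⟨ toℚᵘ-ι (i * j) ⟩
    ℚᵘ.mkℚᵘ (i * j) 0                 ≈⟨ ℚᵘP.*-cong (toℚᵘ-ι i) (toℚᵘ-ι j) ⟨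
    ℚ.toℚᵘ (ι i) ℚᵘ.* ℚ.toℚᵘ (ι j)    ≈⟨ ℚP.toℚᵘ-homo-* (ι i) (ι j) ⟨
    ℚ.toℚᵘ (ι i ℚ.* ι j)              ∎)
    where open ℚᵘP.≃-Reasoning

  ι-+ : ∀ i j → ι (i + j) ≡ ι i ℚ.+ ι j
  ι-+ i j = ℚP.toℚᵘ-injective (begin
    ℚ.toℚᵘ (ι (i + j))                ≈⟨ toℚᵘ-ι (i + j) ⟩
    ℚᵘ.mkℚᵘ (i + j) 0                 ≈⟨ ℚᵘ.*≡* (unit-denominators i j) ⟩
    ℚᵘ.mkℚᵘ i 0 ℚᵘ.+ ℚᵘ.mkℚᵘ j 0      ≈⟨ ℚᵘP.+-cong (toℚᵘ-ι i) (toℚᵘ-ι j) ⟨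
    ℚ.toℚᵘ (ι i) ℚᵘ.+ ℚ.toℚᵘ (ι j)    ≈⟨ ℚP.toℚᵘ-homo-+ (ι i) (ι j) ⟨
    ℚ.toℚᵘ (ι i ℚ.+ ι j)              ∎)
    where
    open ℚᵘP.≃-Reasoning
    unit-denominators : ∀ i j → (i + j) * + 1 ≡ (i * + 1 + j * + 1) * + 1
    unit-denominators = solve-∀

  ι-neg : ∀ i → ι (- i) ≡ ℚ.- ι i
  ι-neg i = ℚP.toℚᵘ-injective (begin
    ℚ.toℚᵘ (ι (- i))       ≈⟨ toℚᵘ-ι (- i) ⟩
    ℚᵘ.mkℚᵘ (- i) 0        ≈⟨ ℚᵘP.-‿cong (toℚᵘ-ι i) ⟨
    ℚᵘ.- ℚ.toℚᵘ (ι i)      ≈⟨ ℚP.toℚᵘ-homo‿- (ι i) ⟨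
    ℚ.toℚᵘ (ℚ.- ι i)       ∎)
    where open ℚᵘP.≃-Reasoning

  ι-minus : ∀ i j → ι (i - j) ≡ ι i ℚ.- ι j
  ι-minus i j = trans (ι-+ i (- j)) (cong (ι i ℚ.+_) (ι-neg j))

  -- Elements of L with polynomial coordinates. _*ᴾ_ copies the formula of _*L_, so that
  -- ⟦ p *ᴾ q ⟧ᴸ ρ unfolds to ⟦ p ⟧ᴸ ρ *L ⟦ q ⟧ᴸ ρ and identities in L can be proved by
  -- normalising each coordinate.
  record Lᴾ (n : ℕ) : Set where
    constructor mkLᴾ
    field
      p₀ p₁ p₂ p₃ : Polynomial n

  infixl 6 _+ᴾ_
  infixl 7 _*ᴾ_

  _+ᴾ_ : ∀ {n} → Lᴾ n → Lᴾ n → Lᴾ n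
  mkLᴾ a₀ a₁ a₂ a₃ +ᴾ mkLᴾ b₀ b₁ b₂ b₃ = mkLᴾ (a₀ :+ b₀) (a₁ :+ b₁) (a₂ :+ b₂) (a₃ :+ b₃)

  _*ᴾ_ : ∀ {n} → Lᴾ n → Lᴾ n → Lᴾ n
  mkLᴾ a₀ a₁ a₂ a₃ *ᴾ mkLᴾ b₀ b₁ b₂ b₃ = mkLᴾ
    (a₀ :* b₀ :+ k (ℤ.- + 105) :* (a₁ :* b₁) :+ k (+ 6) :* (a₂ :* b₂) :+ k (ℤ.- + 630) :* (a₃ :* b₃))
    (a₀ :* b₁ :+ a₁ :* b₀ :+ k (+ 6) :* (a₂ :* b₃ :+ a₃ :* b₂))
    (a₀ :* b₂ :+ a₂ :* b₀ :+ k (ℤ.- + 105) :* (a₁ :* b₃ :+ a₃ :* b₁))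
    (a₀ :* b₃ :+ a₃ :* b₀ :+ a₁ :* b₂ :+ a₂ :* b₁)
    where
    k : ℤ → Polynomial _
    k c = con (c / 1)

  ⟦_⟧ᴸ : ∀ {n} → Lᴾ n → Vec ℚ n → L
  ⟦ p ⟧ᴸ ρ = mkL (⟦ p₀ ⟧ ρ) (⟦ p₁ ⟧ ρ) (⟦ p₂ ⟧ ρ) (⟦ p₃ ⟧ ρ)
    where open Lᴾ p

  coordinates : ∀ {k} → Vec L k → Vec ℚ (k ℕ.* 4)
  coordinates xs = concat (map (λ { (mkL c₀ c₁ c₂ c₃) → c₀ ∷ c₁ ∷ c₂ ∷ c₃ ∷ [] }) xs)

  atoms : ∀ {k} → Vec (Lᴾ (k ℕ.* 4)) k
  atoms = tabulate λ i →
    mkLᴾ (var (combine i (# 0))) (var (combine i (# 1))) (var (combine i (# 2))) (var (combine i (# 3)))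

  L-by-normalisation : ∀ {n} (ρ : Vec ℚ n) (p q : Lᴾ n) → let open Lᴾ in
    ⟦ p₀ p ⟧↓ ρ ≡ ⟦ p₀ q ⟧↓ ρ × ⟦ p₁ p ⟧↓ ρ ≡ ⟦ p₁ q ⟧↓ ρ ×
    ⟦ p₂ p ⟧↓ ρ ≡ ⟦ p₂ q ⟧↓ ρ × ⟦ p₃ p ⟧↓ ρ ≡ ⟦ p₃ q ⟧↓ ρ →
    ⟦ p ⟧ᴸ ρ ≡ ⟦ q ⟧ᴸ ρ
  L-by-normalisation ρ p q (e₀ , e₁ , e₂ , e₃) =
    cong₄ (prove ρ (p₀ p) (p₀ q) e₀) (prove ρ (p₁ p) (p₁ q) e₁)
          (prove ρ (p₂ p) (p₂ q) e₂) (prove ρ (p₃ p) (p₃ q) e₃)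
    where
    open Lᴾ
    cong₄ : ∀ {a₀ a₁ a₂ a₃ b₀ b₁ b₂ b₃} →
      a₀ ≡ b₀ → a₁ ≡ b₁ → a₂ ≡ b₂ → a₃ ≡ b₃ → mkL a₀ a₁ a₂ a₃ ≡ mkL b₀ b₁ b₂ b₃
    cong₄ refl refl refl refl = refl

  L-ring-identity : ∀ {k} (xs : Vec L k) (f g : N-ary k (Lᴾ (k ℕ.* 4)) (Lᴾ (k ℕ.* 4))) →
    let open Lᴾ; ρ = coordinates xs; p = f $ⁿ atoms; q = g $ⁿ atoms in
    ⟦ p₀ p ⟧↓ ρ ≡ ⟦ p₀ q ⟧↓ ρ × ⟦ p₁ p ⟧↓ ρ ≡ ⟦ p₁ q ⟧↓ ρ ×
    ⟦ p₂ p ⟧↓ ρ ≡ ⟦ p₂ q ⟧↓ ρ × ⟦ p₃ p ⟧↓ ρ ≡ ⟦ p₃ q ⟧↓ ρ →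
    ⟦ p ⟧ᴸ ρ ≡ ⟦ q ⟧ᴸ ρ
  L-ring-identity xs f g = L-by-normalisation (coordinates xs) (f $ⁿ atoms) (g $ⁿ atoms)

  OK→L-+K : ∀ x y → OK→L (x +K y) ≡ OK→L x +L OK→L y
  OK→L-+K (mkOK a b) (mkOK c d) = cong₂ (λ r i → mkL r i 0ℚ 0ℚ) (ι-+ a c) (ι-+ b d)

  OK→L-*K : ∀ x y → OK→L (x *K y) ≡ OK→L x *L OK→L y
  OK→L-*K (mkOK a b) (mkOK c d) = begin
    OK→L (mkOK a b *K mkOK c d)
      ≡⟨ cong₂ (λ r i → mkL r i 0ℚ 0ℚ)
           (trans (ι-minus (a * c) (+ 105 * (b * d)))
             (cong₂ ℚ._-_ (ι-* a c) (trans (ι-* (+ 105) (b * d)) (cong (ι (+ 105) ℚ.*_) (ι-* b d)))))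
           (trans (ι-+ (a * d) (b * c)) (cong₂ ℚ._+_ (ι-* a d) (ι-* b c))) ⟩
    mkL (ι a ℚ.* ι c ℚ.- ι (+ 105) ℚ.* (ι b ℚ.* ι d)) (ι a ℚ.* ι d ℚ.+ ι b ℚ.* ι c) 0ℚ 0ℚ
      ≡⟨ L-by-normalisation (ι a ∷ ι b ∷ ι c ∷ ι d ∷ [])
           (okᴾ (a′ :* c′ :- con (ι (+ 105)) :* (b′ :* d′)) (a′ :* d′ :+ b′ :* c′)) (okᴾ a′ b′ *ᴾ okᴾ c′ d′)
           (refl , refl , refl , refl) ⟩
    OK→L (mkOK a b) *L OK→L (mkOK c d) ∎
    where
    open ≡-Reasoning
    a′ b′ c′ d′ : Polynomial 4
    a′ = var (# 0); b′ = var (# 1); c′ = var (# 2); d′ = var (# 3)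
    okᴾ : Polynomial 4 → Polynomial 4 → Lᴾ 4
    okᴾ r i = mkLᴾ r i (con 0ℚ) (con 0ℚ)

  OK→L-^K : ∀ x k → OK→L (x ^K k) ≡ OK→L x ^L k
  OK→L-^K x zero = refl
  OK→L-^K x (suc k) = trans (OK→L-*K x (x ^K k)) (cong (OK→L x *L_) (OK→L-^K x k))

  OK→L-injective : ∀ {x y} → OK→L x ≡ OK→L y → x ≡ y
  OK→L-injective {mkOK a b} {mkOK c d} eq = cong₂ mkOK (ι-injective (cong L.c₀ eq)) (ι-injective (cong L.c₁ eq))

  ℚᴾ : ∀ {n} → ℚ → Lᴾ n
  ℚᴾ q = mkLᴾ (con q) (con 0ℚ) (con 0ℚ) (con 0ℚ)

  *L-identityˡ : ∀ x → 1L *L x ≡ x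
  *L-identityˡ x = L-ring-identity (x ∷ []) (λ x → ℚᴾ 1ℚ *ᴾ x) (λ x → x) (refl , refl , refl , refl)

  ^L-distribʳ-*L : ∀ x y k → (x *L y) ^L k ≡ x ^L k *L y ^L k
  ^L-distribʳ-*L x y zero = refl
  ^L-distribʳ-*L x y (suc k) = begin
    (x *L y) *L (x *L y) ^L k
      ≡⟨ cong ((x *L y) *L_) (^L-distribʳ-*L x y k) ⟩
    (x *L y) *L (x ^L k *L y ^L k)
      ≡⟨ L-ring-identity (x ∷ y ∷ x ^L k ∷ y ^L k ∷ [])
           (λ x y xᵏ yᵏ → (x *ᴾ y) *ᴾ (xᵏ *ᴾ yᵏ)) (λ x y xᵏ yᵏ → (x *ᴾ xᵏ) *ᴾ (y *ᴾ yᵏ))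
           (refl , refl , refl , refl) ⟩
    (x *L x ^L k) *L (y *L y ^L k)
      ∎
    where open ≡-Reasoning

  √6-quotient : ∀ s x y z w d → s *L s ≡ ℤ→L (+ 6) → x *L s ≡ OK→L z → y *L s ≡ OK→L w →
    z *K w ≡ fromℤK (+ 6) *K d → x *L y ≡ OK→L d
  √6-quotient s x y z w d s²≡6 xs≡z ys≡w zw≡6d = begin
    x *L y
      ≡⟨ L-ring-identity (x ∷ y ∷ []) _*ᴾ_ (λ x y → ((x *ᴾ y) *ᴾ six) *ᴾ sixth) (refl , refl , refl , refl) ⟩
    ((x *L y) *L ℤ→L (+ 6)) *L one-sixth
      ≡⟨ cong (λ t → ((x *L y) *L t) *L one-sixth) s²≡6 ⟨
    ((x *L y) *L (s *L s)) *L one-sixth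
      ≡⟨ cong (_*L one-sixth) (L-ring-identity (x ∷ y ∷ s ∷ [])
           (λ x y s → (x *ᴾ y) *ᴾ (s *ᴾ s)) (λ x y s → (x *ᴾ s) *ᴾ (y *ᴾ s)) (refl , refl , refl , refl)) ⟩
    ((x *L s) *L (y *L s)) *L one-sixth
      ≡⟨ cong₂ (λ u v → (u *L v) *L one-sixth) xs≡z ys≡w ⟩
    (OK→L z *L OK→L w) *L one-sixth
      ≡⟨ cong (_*L one-sixth) (OK→L-*K z w) ⟨
    OK→L (z *K w) *L one-sixth
      ≡⟨ cong (λ t → OK→L t *L one-sixth) zw≡6d ⟩
    OK→L (fromℤK (+ 6) *K d) *L one-sixth
      ≡⟨ cong (_*L one-sixth) (OK→L-*K (fromℤK (+ 6)) d) ⟩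
    (ℤ→L (+ 6) *L OK→L d) *L one-sixth
      ≡⟨ L-ring-identity (OK→L d ∷ []) (λ d → (six *ᴾ d) *ᴾ sixth) (λ d → d) (refl , refl , refl , refl) ⟩
    OK→L d
      ∎
    where
    open ≡-Reasoning
    one-sixth : L
    one-sixth = mkL (+ 1 / 6) 0ℚ 0ℚ 0ℚ
    six sixth : ∀ {n} → Lᴾ n
    six = ℚᴾ (+ 6 / 1)
    sixth = ℚᴾ (+ 1 / 6)

  square-in-OK⇒algebraic-integer : ∀ x d → x *L x ≡ OK→L d → IsAlgebraicInteger x
  square-in-OK⇒algebraic-integer x d x²≡d = 4 , coefficients , root
    where
    open ≡-Reasoning
    coefficients : Vec ℤ 4
    coefficients = nrm d ∷ + 0 ∷ - tr d ∷ + 0 ∷ []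
    root : evalMonic coefficients x ≡ 0L
    root = begin
      evalMonic coefficients x
        ≡⟨ L-ring-identity (x ∷ ℤ→L (- tr d) ∷ ℤ→L (nrm d) ∷ [])
             (λ x c₂ c₀ → (((ℚᴾ 1ℚ *ᴾ x +ᴾ ℚᴾ 0ℚ) *ᴾ x +ᴾ c₂) *ᴾ x +ᴾ ℚᴾ 0ℚ) *ᴾ x +ᴾ c₀)
             (λ x c₂ c₀ → (x *ᴾ x +ᴾ c₂) *ᴾ (x *ᴾ x) +ᴾ c₀)
             (refl , refl , refl , refl) ⟩
      (x *L x +L ℤ→L (- tr d)) *L (x *L x) +L ℤ→L (nrm d)
        ≡⟨ cong (λ t → (t +L ℤ→L (- tr d)) *L t +L ℤ→L (nrm d)) x²≡d ⟩
      (OK→L d +L OK→L (fromℤK (- tr d))) *L OK→L d +L ℤ→L (nrm d)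
        ≡⟨ cong (λ t → t *L OK→L d +L ℤ→L (nrm d)) (OK→L-+K d (fromℤK (- tr d))) ⟨
      OK→L (d +K fromℤK (- tr d)) *L OK→L d +L ℤ→L (nrm d)
        ≡⟨ cong (_+L ℤ→L (nrm d)) (OK→L-*K (d +K fromℤK (- tr d)) d) ⟨
      OK→L ((d +K fromℤK (- tr d)) *K d) +L ℤ→L (nrm d)
        ≡⟨ OK→L-+K ((d +K fromℤK (- tr d)) *K d) (fromℤK (nrm d)) ⟨
      OK→L ((d +K fromℤK (- tr d)) *K d +K fromℤK (nrm d))
        ≡⟨ cong OK→L (cayley-hamilton d) ⟩
      0L ∎

  module QuotientsBy√6 (γ δ : OK) (n : ℤ) (s α β : L)
    (γ²≡6δ : γ *K γ ≡ fromℤK (+ 6) *K δ) (γγ̄≡6n : γ *K conjK γ ≡ fromℤK (+ 6) *K fromℤK n)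
    (s²≡6 : s *L s ≡ ℤ→L (+ 6)) (αs≡γ : α *L s ≡ OK→L γ) (βs≡γ̄ : β *L s ≡ OK→L (conjK γ)) where

    α²≡δ : α *L α ≡ OK→L δ
    α²≡δ = √6-quotient s α α γ γ δ s²≡6 αs≡γ αs≡γ γ²≡6δ

    β²≡δ̄ : β *L β ≡ OK→L (conjK δ)
    β²≡δ̄ = √6-quotient s β β (conjK γ) (conjK γ) (conjK δ) s²≡6 βs≡γ̄ βs≡γ̄ (begin
      conjK γ *K conjK γ              ≡⟨ conjK-*K γ γ ⟨
      conjK (γ *K γ)                  ≡⟨ cong conjK γ²≡6δ ⟩
      conjK (fromℤK (+ 6) *K δ)       ≡⟨ conjK-*K (fromℤK (+ 6)) δ ⟩
      fromℤK (+ 6) *K conjK δ         ∎)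
      where open ≡-Reasoning

    αβ≡n : α *L β ≡ ℤ→L n
    αβ≡n = √6-quotient s α β γ (conjK γ) (fromℤK n) s²≡6 αs≡γ βs≡γ̄ γγ̄≡6n

    [α+β]²≡trδ+2n : (α +L β) *L (α +L β) ≡ ℤ→L (tr δ + (n + n))
    [α+β]²≡trδ+2n = begin
      (α +L β) *L (α +L β)
        ≡⟨ L-ring-identity (α ∷ β ∷ []) (λ α β → (α +ᴾ β) *ᴾ (α +ᴾ β))
             (λ α β → (α *ᴾ α +ᴾ β *ᴾ β) +ᴾ (α *ᴾ β +ᴾ α *ᴾ β)) (refl , refl , refl , refl) ⟩
      (α *L α +L β *L β) +L (α *L β +L α *L β)
        ≡⟨ cong₂ _+L_ (cong₂ _+L_ α²≡δ β²≡δ̄) (cong₂ _+L_ αβ≡n αβ≡n) ⟩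
      (OK→L δ +L OK→L (conjK δ)) +L (ℤ→L n +L ℤ→L n)
        ≡⟨ cong₂ _+L_ (OK→L-+K δ (conjK δ)) (OK→L-+K (fromℤK n) (fromℤK n)) ⟨
      OK→L (δ +K conjK δ) +L ℤ→L (n + n)
        ≡⟨ cong (λ t → OK→L t +L ℤ→L (n + n)) (+K-conjK δ) ⟩
      ℤ→L (tr δ) +L ℤ→L (n + n)
        ≡⟨ OK→L-+K (fromℤK (tr δ)) (fromℤK (n + n)) ⟨
      ℤ→L (tr δ + (n + n))
        ∎
      where open ≡-Reasoning

    root-of-unity⇒δ-power-real : ∀ ζ → ζ *L β ≡ α → IsRootOfUnity ζ → ∃ λ k → δ ^K suc k ≡ conjK δ ^K suc k
    root-of-unity⇒δ-power-real ζ ζβ≡α (zero , () , _)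
    root-of-unity⇒δ-power-real ζ ζβ≡α (suc k , _ , ζᵏ≡1) = k , OK→L-injective (begin
      OK→L (δ ^K suc k)                   ≡⟨ OK→L-^K δ (suc k) ⟩
      OK→L δ ^L suc k                     ≡⟨ cong (_^L suc k) α²≡δ ⟨
      (α *L α) ^L suc k                   ≡⟨ ^L-distribʳ-*L α α (suc k) ⟩
      α ^L suc k *L α ^L suc k            ≡⟨ cong₂ _*L_ αᵏ≡βᵏ αᵏ≡βᵏ ⟩
      β ^L suc k *L β ^L suc k            ≡⟨ ^L-distribʳ-*L β β (suc k) ⟨
      (β *L β) ^L suc k                   ≡⟨ cong (_^L suc k) β²≡δ̄ ⟩
      OK→L (conjK δ) ^L suc k             ≡⟨ OK→L-^K (conjK δ) (suc k) ⟨
      OK→L (conjK δ ^K suc k)             ∎)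
      where
      open ≡-Reasoning
      αᵏ≡βᵏ : α ^L suc k ≡ β ^L suc k
      αᵏ≡βᵏ = begin
        α ^L suc k                  ≡⟨ cong (_^L suc k) ζβ≡α ⟨
        (ζ *L β) ^L suc k           ≡⟨ ^L-distribʳ-*L ζ β (suc k) ⟩
        ζ ^L suc k *L β ^L suc k    ≡⟨ cong (_*L β ^L suc k) ζᵏ≡1 ⟩
        1L *L β ^L suc k            ≡⟨ *L-identityˡ (β ^L suc k) ⟩
        β ^L suc k                  ∎

module ArithmeticOfγ (A B n : ℤ) (2∤A : ¬ + 2 ∣ A) (2∤n : ¬ + 2 ∣ n) (3∤B : ¬ + 3 ∣ B)
  (2n≡3A²+35B² : + 2 * n ≡ + 3 * (A * A) + + 35 * (B * B))
  (p k : ℕ) (im-γᵖ : im (mkOK (+ 3 * A) B ^K suc (suc p)) ≡ (+ 6) ^ k) where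

  γ δ : OK
  γ = mkOK (+ 3 * A) B
  δ = mkOK (+ 3 * (A * A) - n) (A * B)

  nrm-γ : nrm γ ≡ + 6 * n
  nrm-γ = begin
    + 3 * A * (+ 3 * A) + + 105 * (B * B)    ≡⟨ solve (A ∷ B ∷ []) ⟩
    + 3 * (+ 3 * (A * A) + + 35 * (B * B))   ≡⟨ cong (λ t → + 3 * t) 2n≡3A²+35B² ⟨
    + 3 * (+ 2 * n)                          ≡⟨ solve (n ∷ []) ⟩
    + 6 * n                                  ∎
    where open ≡-Reasoning

  γγ̄≡6n : γ *K conjK γ ≡ fromℤK (+ 6) *K fromℤK n
  γγ̄≡6n = trans (*K-conjK γ) (trans (cong fromℤK nrm-γ) (sym (fromℤK-*K (+ 6) (fromℤK n))))

  γ²≡6δ : γ *K γ ≡ fromℤK (+ 6) *K δ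
  γ²≡6δ = trans (cong₂ mkOK re-γ² im-γ²) (sym (fromℤK-*K (+ 6) δ))
    where
    open ≡-Reasoning
    im-γ² : + 3 * A * B + B * (+ 3 * A) ≡ + 6 * (A * B)
    im-γ² = solve (A ∷ B ∷ [])
    re-γ² : + 3 * A * (+ 3 * A) - + 105 * (B * B) ≡ + 6 * (+ 3 * (A * A) - n)
    re-γ² = begin
      + 3 * A * (+ 3 * A) - + 105 * (B * B)
        ≡⟨ solve (A ∷ B ∷ []) ⟩
      + 18 * (A * A) - + 3 * (+ 3 * (A * A) + + 35 * (B * B))
        ≡⟨ cong (λ t → + 18 * (A * A) - + 3 * t) 2n≡3A²+35B² ⟨
      + 18 * (A * A) - + 3 * (+ 2 * n)
        ≡⟨ solve (A ∷ n ∷ []) ⟩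
      + 6 * (+ 3 * (A * A) - n)
        ∎

  nrm-δ : nrm δ ≡ n * n
  nrm-δ = begin
    (+ 3 * (A * A) - n) * (+ 3 * (A * A) - n) + + 105 * (A * B * (A * B))
      ≡⟨ solve (A ∷ B ∷ n ∷ []) ⟩
    n * n + + 3 * (A * A) * (+ 3 * (A * A) + + 35 * (B * B) - + 2 * n)
      ≡⟨ cong (λ t → n * n + + 3 * (A * A) * (t - + 2 * n)) 2n≡3A²+35B² ⟨
    n * n + + 3 * (A * A) * (+ 2 * n - + 2 * n)
      ≡⟨ solve (A ∷ n ∷ []) ⟩
    n * n ∎
    where open ≡-Reasoning

  trδ+2n≡6A² : tr δ + (n + n) ≡ + 6 * (A * A)
  trδ+2n≡6A² = begin
    + 2 * (+ 3 * (A * A) - n) + (n + n)   ≡⟨ solve (A ∷ n ∷ []) ⟩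
    + 6 * (A * A)                         ∎
    where open ≡-Reasoning

  3∤35B² : ¬ + 3 ∣ + 35 * (B * B)
  3∤35B² 3∣35B² =
    [ 3∤35 , 3∤B ∘ reduce ∘ euclidsLemmaℤ B B prime[3] ]′ (euclidsLemmaℤ (+ 35) (B * B) prime[3] 3∣35B²)

  no-common-prime-factor : ∀ {ℓ} → Prime ℓ → + ℓ ∣ + 6 * (A * A) → + ℓ ∣ n → ⊥
  no-common-prime-factor {ℓ} ℓ-prime ℓ∣6A² ℓ∣n = [ ℓ≢2 , ℓ≢3 ]′ (prime∣6⇒2⊎3 ℓ-prime ℓ∣6)
    where
    ℓ≢2 : ℓ ≢ 2
    ℓ≢2 refl = 2∤n ℓ∣n
    ℓ∣3A² : + ℓ ∣ + 3 * (A * A)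
    ℓ∣3A² = [ ⊥-elim ∘ ℓ≢2 ∘ prime∣prime⇒≡ ℓ-prime prime[2] , id ]′
      (euclidsLemmaℤ (+ 2) (+ 3 * (A * A)) ℓ-prime (subst (+ ℓ ∣_) (ℤP.*-assoc (+ 2) (+ 3) (A * A)) ℓ∣6A²))
    ℓ∣35B² : + ℓ ∣ + 35 * (B * B)
    ℓ∣35B² = ∣m+n∣m⇒∣n (subst (+ ℓ ∣_) 2n≡3A²+35B² (∣n⇒∣m*n (+ 2) ℓ∣n)) ℓ∣3A²
    ℓ≢3 : ℓ ≢ 3
    ℓ≢3 refl = 3∤35B² ℓ∣35B²
    ℓ∣A : + ℓ ∣ A
    ℓ∣A = [ ⊥-elim ∘ ℓ≢3 ∘ prime∣prime⇒≡ ℓ-prime prime[3] , reduce ∘ euclidsLemmaℤ A A ℓ-prime ]′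
      (euclidsLemmaℤ (+ 3) (A * A) ℓ-prime ℓ∣3A²)
    ℓ∣3A : + ℓ ∣ + 3 * A
    ℓ∣3A = ∣n⇒∣m*n (+ 3) ℓ∣A
    ℓ∣γ² : + ℓ ∣K γ *K γ
    ℓ∣γ² = subst (+ ℓ ∣_) re-γ² (∣m∣n⇒∣m-n (∣n⇒∣m*n (+ 9 * A) ℓ∣A) (∣n⇒∣m*n (+ 3) ℓ∣35B²))
         , ∣m∣n⇒∣m+n (∣m⇒∣m*n B ℓ∣3A) (∣n⇒∣m*n B ℓ∣3A)
      where
      re-γ² : + 9 * A * A - + 3 * (+ 35 * (B * B)) ≡ + 3 * A * (+ 3 * A) - + 105 * (B * B)
      re-γ² = solve (A ∷ B ∷ [])
    ℓ∣6 : + ℓ ∣ + 6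
    ℓ∣6 = prime∣^⇒prime∣ (+ 6) k ℓ-prime (subst (+ ℓ ∣_) im-γᵖ (proj₂ (∣K-square⇒∣K-^ γ p ℓ∣γ²)))

  n≢0 : n ≢ + 0
  n≢0 refl = 2∤n (divides (+ 0) refl)

  6A²≢0 : + 6 * (A * A) ≢ + 0
  6A²≢0 6A²≡0 = [ (λ ()) , 2∤A ∘ 2∣0-when ∘ reduce ∘ ℤP.i*j≡0⇒i≡0∨j≡0 A ]′ (ℤP.i*j≡0⇒i≡0∨j≡0 (+ 6) 6A²≡0)
    where
    2∣0-when : A ≡ + 0 → + 2 ∣ A
    2∣0-when refl = divides (+ 0) refl

  6A²-coprime-n : gcd (+ 6 * (A * A)) n ≡ + 1
  6A²-coprime-n = no-common-prime⇒gcd≡1 (+ 6 * (A * A)) n n≢0 no-common-prime-factor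

  δ-powers-not-real : (∃ λ ℓ → Prime ℓ × + ℓ ∣ n) → ¬ ∃ λ j → δ ^K suc j ≡ conjK δ ^K suc j
  δ-powers-not-real (ℓ , ℓ-prime , ℓ∣n) (j , δʲ≡δ̄ʲ) = no-common-prime-factor ℓ-prime ℓ∣6A² ℓ∣n
    where
    ℓ∣trδ : + ℓ ∣ tr δ
    ℓ∣trδ = real-power⇒prime∣nrm⇒prime∣tr δ j δʲ≡δ̄ʲ ℓ-prime (subst (+ ℓ ∣_) (sym nrm-δ) (∣m⇒∣m*n n ℓ∣n))
    ℓ∣6A² : + ℓ ∣ + 6 * (A * A)
    ℓ∣6A² = subst (+ ℓ ∣_) trδ+2n≡6A² (∣m∣n⇒∣m+n ℓ∣trδ (∣m∣n⇒∣m+n ℓ∣n ℓ∣n))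

-- (3A² + 35B²)/2 for A = 1 + 2i and B = 1 + 2j, written so that it is visibly at least 19.
half-norm : ℤ → ℤ → ℤ
half-norm i j = + 19 + + 6 * (i * (+ 1 + i)) + + 70 * (j * (+ 1 + j))

twice-half-norm : ∀ i j →
  + 2 * half-norm i j ≡ + 3 * ((+ 1 + + 2 * i) * (+ 1 + + 2 * i)) + + 35 * ((+ 1 + + 2 * j) * (+ 1 + + 2 * j))
twice-half-norm i j = begin
  + 2 * (+ 19 + + 6 * (i * (+ 1 + i)) + + 70 * (j * (+ 1 + j)))
    ≡⟨ solve (i ∷ j ∷ []) ⟩
  + 3 * ((+ 1 + + 2 * i) * (+ 1 + + 2 * i)) + + 35 * ((+ 1 + + 2 * j) * (+ 1 + + 2 * j)) ∎
  where open ≡-Reasoning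

half-norm-odd : ∀ i j → ¬ + 2 ∣ half-norm i j
half-norm-odd i j = subst (λ m → ¬ + 2 ∣ m) (sym odd-form) (2∤1+2i h)
  where
  open ≡-Reasoning
  h : ℤ
  h = + 9 + + 3 * (i * (+ 1 + i)) + + 35 * (j * (+ 1 + j))
  odd-form : half-norm i j ≡ + 1 + + 2 * h
  odd-form = begin
    + 19 + + 6 * (i * (+ 1 + i)) + + 70 * (j * (+ 1 + j))
      ≡⟨ solve (i ∷ j ∷ []) ⟩
    + 1 + + 2 * (+ 9 + + 3 * (i * (+ 1 + i)) + + 35 * (j * (+ 1 + j))) ∎

i*[1+i]-natural : ∀ i → ∃ λ t → i * (+ 1 + i) ≡ + t
i*[1+i]-natural (+ t) = t ℕ.* suc t , sym (ℤP.pos-* t (suc t))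
i*[1+i]-natural -[1+ t ] = suc t ℕ.* t , trans (negated (+ t)) (sym (ℤP.pos-* (suc t) t))
  where
  negated : ∀ u → - (+ 1 + u) * (+ 1 + - (+ 1 + u)) ≡ (+ 1 + u) * u
  negated = solve-∀

half-norm-prime-divisor : ∀ i j → ∃ λ ℓ → Prime ℓ × + ℓ ∣ half-norm i j
half-norm-prime-divisor i j with i*[1+i]-natural i | i*[1+i]-natural j
... | s , i[1+i]≡s | t , j[1+j]≡t =
  subst (λ m → ∃ λ ℓ → Prime ℓ × + ℓ ∣ m) (sym n≡) (prime-divisor (17 ℕ.+ 6 ℕ.* s ℕ.+ 70 ℕ.* t))
  where
  open ≡-Reasoning
  n≡ : half-norm i j ≡ + (19 ℕ.+ 6 ℕ.* s ℕ.+ 70 ℕ.* t)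
  n≡ = begin
    + 19 + + 6 * (i * (+ 1 + i)) + + 70 * (j * (+ 1 + j))
      ≡⟨ cong₂ (λ u v → + 19 + + 6 * u + + 70 * v) i[1+i]≡s j[1+j]≡t ⟩
    + 19 + + 6 * + s + + 70 * + t
      ≡⟨ cong₂ (λ u v → + 19 + u + v) (ℤP.pos-* 6 s) (ℤP.pos-* 70 t) ⟨
    + (19 ℕ.+ 6 ℕ.* s ℕ.+ 70 ℕ.* t)
      ∎

lemma4p1 : (p : ℕ) → Prime p → p ≢ 2 → (x y : ℤ) →
    let X = ℤ.+ 6 ℤ.* x ℤ.+ ℤ.+ 21 in
    X ℤ.* X ℤ.+ ℤ.+ 105 ≡ ℤ.+ 6 ℤ.* (y ℤ.^ p) →
    (γ : OK) → ord𝔭₂≡1 γ → ord𝔭₃≡1 γ →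
    fromℤK (ℤ.+ 6) ^K ((p ℕ.∸ 1) ℕ./ 2) *K (fromℤK X +K √-105K) ≡ γ ^K p →
    (s : L) → s *L s ≡ ℤ→L (ℤ.+ 6) →
    (α β : L) → α *L s ≡ OK→L γ → β *L s ≡ OK→L (conjK γ) →
    IsAlgebraicInteger α × IsAlgebraicInteger β
      × Σ ℤ (λ m → Σ ℤ (λ n →
          ((α +L β) *L (α +L β) ≡ ℤ→L m) × (α *L β ≡ ℤ→L n)
          × m ≢ ℤ.+ 0 × n ≢ ℤ.+ 0 × gcd m n ≡ ℤ.+ 1))
      × ((ζ : L) → ζ *L β ≡ α → ¬ IsRootOfUnity ζ)
lemma4p1 zero p-prime = ⊥-elim (¬prime[0] p-prime)
lemma4p1 (suc zero) p-prime = ⊥-elim (¬prime[1] p-prime)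
lemma4p1 p@(suc (suc p′)) _ _ _ _ _ γ₀ ord₂ ord₃ 6ᵏ[X+√-105]≡γ₀ᵖ s s²≡6 α β αs≡γ₀ βs≡γ̄₀ =
    square-in-OK⇒algebraic-integer α δ α²≡δ
  , square-in-OK⇒algebraic-integer β (conjK δ) β²≡δ̄
  , (+ 6 * (A * A) , n , trans [α+β]²≡trδ+2n (cong ℤ→L trδ+2n≡6A²) , αβ≡n , 6A²≢0 , n≢0 , 6A²-coprime-n)
  , λ ζ ζβ≡α → δ-powers-not-real (half-norm-prime-divisor i j) ∘ root-of-unity⇒δ-power-real ζ ζβ≡α
  where
  shape : ∃₂ λ i j → γ₀ ≡ mkOK (+ 3 * (+ 1 + + 2 * i)) (+ 1 + + 2 * j) × ¬ + 3 ∣ + 1 + + 2 * j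
  shape = γ-shape γ₀ ord₂ ord₃
  i j A B n : ℤ
  i = proj₁ shape
  j = proj₁ (proj₂ shape)
  A = + 1 + + 2 * i
  B = + 1 + + 2 * j
  n = half-norm i j
  γ₀≡3A+B√-105 : γ₀ ≡ mkOK (+ 3 * A) B
  γ₀≡3A+B√-105 = proj₁ (proj₂ (proj₂ shape))
  k : ℕ
  k = (p ℕ.∸ 1) ℕ./ 2
  im-γᵖ : im (mkOK (+ 3 * A) B ^K p) ≡ (+ 6) ^ k
  im-γᵖ = trans (cong (λ γ → im (γ ^K p)) (sym γ₀≡3A+B√-105))
    (trans (cong im (sym 6ᵏ[X+√-105]≡γ₀ᵖ)) (trans (im-fromℤK^K-*K (+ 6) k _) (ℤP.*-identityʳ _)))
  open ArithmeticOfγ A B n (2∤1+2i i) (half-norm-odd i j) (proj₂ (proj₂ (proj₂ shape)))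
    (twice-half-norm i j) p′ k im-γᵖ
  open QuotientsBy√6 γ δ n s α β γ²≡6δ γγ̄≡6n s²≡6
    (subst (λ γ → α *L s ≡ OK→L γ) γ₀≡3A+B√-105 αs≡γ₀)
    (subst (λ γ → β *L s ≡ OK→L (conjK γ)) γ₀≡3A+B√-105 βs≡γ̄₀)
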